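{- Let $k\ge2$ and $q_1,q_2\ge1$ be integers and $m$ a number. If $\gamma=\begin{pmatrix}a&b\\c&d\end{pmatrix}\in\Gamma_1(q_1q_2)$ with $c\ne0$ and $\mathcal P_0\in\mathcal P(k;m,q_1)$, then $c^{k-2}\mathcal P_0(\gamma\infty)=c^{k-2}\mathcal P_0(a/c)\in m\mathbb Z/q_1=\{mt/q_1:t\in\mathbb Z\}$.
   Context: $\mathcal P(k;m,q)=\{\sum_{n=0}^{k-2}a_nx^{k-n-2}\in\mathbb Q[x]: q^{n+1}a_n\in m\mathbb Z\text{ for all }n\}$, where $m\mathbb Z=\{mt:t\in\mathbb Z\}$. -}

module Defs where

open import Data.Nat as ℕ using (ℕ; zero; suc; _∸_; NonZero)
open import Data.Integer as ℤ using (ℤ; +_; -[1+_])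
open import Data.Integer.Divisibility using (_∣_)
open import Data.Rational as ℚ using (ℚ; _/_)
open import Data.Fin using (Fin; toℕ)
open import Data.Product using (∃; _×_)
open import Relation.Binary.PropositionalEquality using (_≡_; _≢_; refl)
open import Data.Empty using (⊥-elim)

ℤ→ℚ : ℤ → ℚ
ℤ→ℚ z = z / 1

_^ℚ_ : ℚ → ℕ → ℚ
x ^ℚ zero  = ℚ.1ℚ
x ^ℚ suc n = x ℚ.* (x ^ℚ n)

sumFin : (n : ℕ) → (Fin n → ℚ) → ℚ
sumFin zero    f = ℚ.0ℚ
sumFin (suc n) f = f Fin.zero ℚ.+ sumFin n (λ i → f (Fin.suc i))
  where import Data.Fin as Fin

fracℤ : (a c : ℤ) → c ≢ + 0 → ℚ
fracℤ a (+ zero)    c≢0 = ⊥-elim (c≢0 refl)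
fracℤ a (+ suc n)   _   = a / suc n
fracℤ a (-[1+ n ])  _   = (ℤ.- a) / suc n

-- A polynomial  Σ_{n=0}^{k-2} a_n x^{k-n-2} ∈ ℚ[x], given by its
-- coefficient family  a : Fin (k ∸ 1) → ℚ  (a n = a_n, n = 0,…,k-2).
Poly : ℕ → Set
Poly k = Fin (k ∸ 1) → ℚ

evalPoly : (k : ℕ) → Poly k → ℚ → ℚ
evalPoly k a x = sumFin (k ∸ 1) (λ n → a n ℚ.* (x ^ℚ (k ∸ toℕ n ∸ 2)))

inP : (k : ℕ) (m : ℚ) (q : ℕ) → Poly k → Set
inP k m q a = ∀ (n : Fin (k ∸ 1)) →
  ∃ λ (t : ℤ) → ℤ→ℚ (+ (q ℕ.^ suc (toℕ n))) ℚ.* a n ≡ m ℚ.* ℤ→ℚ t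

inMZdiv : (m : ℚ) (q : ℕ) .{{_ : NonZero q}} → ℚ → Set
inMZdiv m q x = ∃ λ (t : ℤ) → x ≡ (m ℚ.* ℤ→ℚ t) ℚ.* (+ 1 / q)

record Γ₁ (N : ℕ) : Set where
  field
    a b c d : ℤ
    det  : a ℤ.* d ℤ.- b ℤ.* c ≡ + 1
    a≡1  : + N ∣ a ℤ.- + 1
    d≡1  : + N ∣ d ℤ.- + 1
    c≡0  : + N ∣ c

{-# OPTIONS --safe #-}
module Submission where

-- Write c = w q₁; only this much of γ ∈ Γ₁(q₁q₂) is used. Clearing the denominator of a/c,
-- c^(k-2) P₀(a/c) = Σₙ aₙ a^(k-2-n) cⁿ, and the n-th term is the integer wⁿ a^(k-2-n) times
-- q₁ⁿ aₙ = (q₁^(n+1) aₙ)/q₁ ∈ mℤ/q₁. Since mℤ/q₁ is closed under sums and integer multiples,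
-- the whole sum lies in it. For k < 2 the sum is empty.

open import Defs
open import Data.Nat as ℕ using (ℕ; _≤_; _∸_; NonZero)
open import Data.Integer as ℤ using (ℤ; +_)
open import Data.Rational as ℚ using (ℚ)
open import Relation.Binary.PropositionalEquality using (_≢_)

open import Data.Nat using (zero; suc)
import Data.Nat.Properties as ℕ
import Data.Nat.Divisibility as ℕ
open import Data.Integer using (-[1+_])
import Data.Integer.Properties as ℤ
import Data.Integer.Divisibility.Signed as ℤˢ
open import Data.Rational using (_/_; _+_; _*_; -_; toℚᵘ)
import Data.Rational.Properties as ℚ
open import Data.Rational.Unnormalised as ℚᵘ using (mkℚᵘ; *≡*; _≃_)
import Data.Rational.Unnormalised.Properties as ℚᵘ
open import Algebra.Bundles using (CommutativeMonoid)
open import Algebra.Properties.CommutativeSemigroup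
  (CommutativeMonoid.commutativeSemigroup ℚ.*-1-commutativeMonoid)
  using (interchange; x∙yz≈y∙xz; xy∙z≈yz∙x; xy∙z≈xz∙y)
open import Data.Fin using (Fin; zero; suc; toℕ)
import Data.Fin.Properties as Fin
open import Data.Product using (∃; _,_)
open import Function using (_∘_)
open import Data.Empty using (⊥-elim)
open import Relation.Binary.PropositionalEquality
  using (_≡_; refl; sym; trans; cong; cong₂; subst; module ≡-Reasoning)

toℚᵘ-/ : ∀ i d → toℚᵘ (i / suc d) ≃ mkℚᵘ i d
toℚᵘ-/ i d = ℚ.toℚᵘ-fromℚᵘ (mkℚᵘ i d)

-- ℤ→ℚ i = i / 1 is normalised, so identities about it are checked in ℚᵘ, where it is mkℚᵘ i 0.
module _ where
  open ℚᵘ.≃-Reasoning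

  ℤ→ℚ-+ : ∀ i j → ℤ→ℚ (i ℤ.+ j) ≡ ℤ→ℚ i + ℤ→ℚ j
  ℤ→ℚ-+ i j = ℚ.toℚᵘ-injective (begin
    toℚᵘ (ℤ→ℚ (i ℤ.+ j))            ≈⟨ toℚᵘ-/ (i ℤ.+ j) 0 ⟩
    mkℚᵘ (i ℤ.+ j) 0                 ≈⟨ *≡* cross-multiplied ⟩
    mkℚᵘ i 0 ℚᵘ.+ mkℚᵘ j 0           ≈⟨ ℚᵘ.+-cong (toℚᵘ-/ i 0) (toℚᵘ-/ j 0) ⟨
    toℚᵘ (ℤ→ℚ i) ℚᵘ.+ toℚᵘ (ℤ→ℚ j)  ≈⟨ ℚ.toℚᵘ-homo-+ (ℤ→ℚ i) (ℤ→ℚ j) ⟨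
    toℚᵘ (ℤ→ℚ i + ℤ→ℚ j)            ∎)
    where
    cross-multiplied : (i ℤ.+ j) ℤ.* + 1 ≡ (i ℤ.* + 1 ℤ.+ j ℤ.* + 1) ℤ.* + 1
    cross-multiplied = cong (ℤ._* + 1) (cong₂ ℤ._+_ (sym (ℤ.*-identityʳ i)) (sym (ℤ.*-identityʳ j)))

  ℤ→ℚ-* : ∀ i j → ℤ→ℚ (i ℤ.* j) ≡ ℤ→ℚ i * ℤ→ℚ j
  ℤ→ℚ-* i j = ℚ.toℚᵘ-injective (begin
    toℚᵘ (ℤ→ℚ (i ℤ.* j))            ≈⟨ toℚᵘ-/ (i ℤ.* j) 0 ⟩
    mkℚᵘ i 0 ℚᵘ.* mkℚᵘ j 0           ≈⟨ ℚᵘ.*-cong (toℚᵘ-/ i 0) (toℚᵘ-/ j 0) ⟨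
    toℚᵘ (ℤ→ℚ i) ℚᵘ.* toℚᵘ (ℤ→ℚ j)  ≈⟨ ℚ.toℚᵘ-homo-* (ℤ→ℚ i) (ℤ→ℚ j) ⟨
    toℚᵘ (ℤ→ℚ i * ℤ→ℚ j)            ∎)

  ℤ→ℚ-neg : ∀ i → ℤ→ℚ (ℤ.- i) ≡ - ℤ→ℚ i
  ℤ→ℚ-neg i = ℚ.toℚᵘ-injective (begin
    toℚᵘ (ℤ→ℚ (ℤ.- i))   ≈⟨ toℚᵘ-/ (ℤ.- i) 0 ⟩
    ℚᵘ.- mkℚᵘ i 0         ≈⟨ ℚᵘ.-‿cong (toℚᵘ-/ i 0) ⟨
    ℚᵘ.- toℚᵘ (ℤ→ℚ i)    ≈⟨ ℚ.toℚᵘ-homo‿- (ℤ→ℚ i) ⟨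
    toℚᵘ (- ℤ→ℚ i)       ∎)

  i/n*n≡i : ∀ i n .{{_ : NonZero n}} → i / n * ℤ→ℚ (+ n) ≡ ℤ→ℚ i
  i/n*n≡i i zero ⦃ () ⦄
  i/n*n≡i i (suc d) = ℚ.toℚᵘ-injective (begin
    toℚᵘ (i / suc d * ℤ→ℚ (+ suc d))              ≈⟨ ℚ.toℚᵘ-homo-* (i / suc d) (ℤ→ℚ (+ suc d)) ⟩
    toℚᵘ (i / suc d) ℚᵘ.* toℚᵘ (ℤ→ℚ (+ suc d))   ≈⟨ ℚᵘ.*-cong (toℚᵘ-/ i d) (toℚᵘ-/ (+ suc d) 0) ⟩
    mkℚᵘ i d ℚᵘ.* mkℚᵘ (+ suc d) 0                ≈⟨ *≡* cross-multiplied ⟩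
    mkℚᵘ i 0                                       ≈⟨ toℚᵘ-/ i 0 ⟨
    toℚᵘ (ℤ→ℚ i)                                   ∎)
    where
    cross-multiplied : (i ℤ.* + suc d) ℤ.* + 1 ≡ i ℤ.* + (suc d ℕ.* 1)
    cross-multiplied = trans (ℤ.*-identityʳ _) (cong (λ n → i ℤ.* + n) (sym (ℕ.*-identityʳ (suc d))))

open ≡-Reasoning

fracℤ*c≡a : ∀ a c (c≢0 : c ≢ + 0) → fracℤ a c c≢0 * ℤ→ℚ c ≡ ℤ→ℚ a
fracℤ*c≡a a (+ zero)   c≢0 = ⊥-elim (c≢0 refl)
fracℤ*c≡a a (+ suc n)  _   = i/n*n≡i a (suc n)
-- ℤ→ℚ -[1+ n ] is definitionally - ℤ→ℚ (+ suc n).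
fracℤ*c≡a a -[1+ n ]   _   = begin
  ℤ.- a / suc n * - ℤ→ℚ (+ suc n)      ≡⟨ ℚ.neg-distribʳ-* (ℤ.- a / suc n) (ℤ→ℚ (+ suc n)) ⟨
  - (ℤ.- a / suc n * ℤ→ℚ (+ suc n))    ≡⟨ cong -_ (i/n*n≡i (ℤ.- a) (suc n)) ⟩
  - ℤ→ℚ (ℤ.- a)                         ≡⟨ ℤ→ℚ-neg (ℤ.- a) ⟨
  ℤ→ℚ (ℤ.- ℤ.- a)                       ≡⟨ cong ℤ→ℚ (ℤ.neg-involutive a) ⟩
  ℤ→ℚ a                                 ∎

^ℚ-distribˡ-+-* : ∀ x m n → x ^ℚ (m ℕ.+ n) ≡ x ^ℚ m * x ^ℚ n
^ℚ-distribˡ-+-* x zero    n = sym (ℚ.*-identityˡ (x ^ℚ n))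
^ℚ-distribˡ-+-* x (suc m) n = begin
  x * x ^ℚ (m ℕ.+ n)        ≡⟨ cong (x *_) (^ℚ-distribˡ-+-* x m n) ⟩
  x * (x ^ℚ m * x ^ℚ n)     ≡⟨ ℚ.*-assoc x (x ^ℚ m) (x ^ℚ n) ⟨
  x * x ^ℚ m * x ^ℚ n       ∎

^ℚ-distribʳ-* : ∀ x y n → (x * y) ^ℚ n ≡ x ^ℚ n * y ^ℚ n
^ℚ-distribʳ-* x y zero    = refl
^ℚ-distribʳ-* x y (suc n) = begin
  x * y * (x * y) ^ℚ n      ≡⟨ cong (x * y *_) (^ℚ-distribʳ-* x y n) ⟩
  x * y * (x ^ℚ n * y ^ℚ n) ≡⟨ interchange x y (x ^ℚ n) (y ^ℚ n) ⟩
  x * x ^ℚ n * (y * y ^ℚ n) ∎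

ℤ→ℚ-^ : ∀ i n → ℤ→ℚ (i ℤ.^ n) ≡ ℤ→ℚ i ^ℚ n
ℤ→ℚ-^ i zero    = refl
ℤ→ℚ-^ i (suc n) = trans (ℤ→ℚ-* i (i ℤ.^ n)) (cong (ℤ→ℚ i *_) (ℤ→ℚ-^ i n))

ℤ→ℚ-pos-^ : ∀ q n → ℤ→ℚ (+ (q ℕ.^ n)) ≡ ℤ→ℚ (+ q) ^ℚ n
ℤ→ℚ-pos-^ q zero    = refl
ℤ→ℚ-pos-^ q (suc n) = begin
  ℤ→ℚ (+ (q ℕ.* q ℕ.^ n))           ≡⟨ cong ℤ→ℚ (ℤ.pos-* q (q ℕ.^ n)) ⟩
  ℤ→ℚ (+ q ℤ.* + (q ℕ.^ n))         ≡⟨ ℤ→ℚ-* (+ q) (+ (q ℕ.^ n)) ⟩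
  ℤ→ℚ (+ q) * ℤ→ℚ (+ (q ℕ.^ n))     ≡⟨ cong (ℤ→ℚ (+ q) *_) (ℤ→ℚ-pos-^ q n) ⟩
  ℤ→ℚ (+ q) * ℤ→ℚ (+ q) ^ℚ n        ∎

^ℚ-clear-denominators : ∀ {x C A W Q} → C * x ≡ A → C ≡ W * Q → ∀ j e p →
  C ^ℚ (j ℕ.+ e) * (p * x ^ℚ e) ≡ W ^ℚ j * A ^ℚ e * (Q ^ℚ j * p)
^ℚ-clear-denominators {x} {C} {A} {W} {Q} C*x≡A C≡W*Q j e p = begin
  C ^ℚ (j ℕ.+ e) * (p * x ^ℚ e)          ≡⟨ cong (_* (p * x ^ℚ e)) (^ℚ-distribˡ-+-* C j e) ⟩
  C ^ℚ j * C ^ℚ e * (p * x ^ℚ e)         ≡⟨ interchange (C ^ℚ j) (C ^ℚ e) p (x ^ℚ e) ⟩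
  C ^ℚ j * p * (C ^ℚ e * x ^ℚ e)         ≡⟨ cong (C ^ℚ j * p *_) (^ℚ-distribʳ-* C x e) ⟨
  C ^ℚ j * p * (C * x) ^ℚ e              ≡⟨ cong₂ (λ u v → u ^ℚ j * p * v ^ℚ e) C≡W*Q C*x≡A ⟩
  (W * Q) ^ℚ j * p * A ^ℚ e              ≡⟨ cong (λ u → u * p * A ^ℚ e) (^ℚ-distribʳ-* W Q j) ⟩
  W ^ℚ j * Q ^ℚ j * p * A ^ℚ e           ≡⟨ cong (_* A ^ℚ e) (ℚ.*-assoc (W ^ℚ j) (Q ^ℚ j) p) ⟩
  W ^ℚ j * (Q ^ℚ j * p) * A ^ℚ e         ≡⟨ xy∙z≈xz∙y (W ^ℚ j) (Q ^ℚ j * p) (A ^ℚ e) ⟩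
  W ^ℚ j * A ^ℚ e * (Q ^ℚ j * p)         ∎

*-distribˡ-sumFin : ∀ n r f → r * sumFin n f ≡ sumFin n (λ i → r * f i)
*-distribˡ-sumFin zero    r f = ℚ.*-zeroʳ r
*-distribˡ-sumFin (suc n) r f = begin
  r * (f zero + sumFin n (f ∘ suc))             ≡⟨ ℚ.*-distribˡ-+ r (f zero) (sumFin n (f ∘ suc)) ⟩
  r * f zero + r * sumFin n (f ∘ suc)           ≡⟨ cong (_+_ (r * f zero)) (*-distribˡ-sumFin n r (f ∘ suc)) ⟩
  r * f zero + sumFin n (λ i → r * f (suc i))   ∎

toℕ+[k∸toℕ∸2]≡k∸2 : ∀ k (n : Fin (k ∸ 1)) → toℕ n ℕ.+ (k ∸ toℕ n ∸ 2) ≡ k ∸ 2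
toℕ+[k∸toℕ∸2]≡k∸2 (suc (suc k)) n = begin
  toℕ n ℕ.+ (suc (suc k) ∸ toℕ n ∸ 2)      ≡⟨ cong (toℕ n ℕ.+_) (ℕ.∸-+-assoc (suc (suc k)) (toℕ n) 2) ⟩
  toℕ n ℕ.+ (suc (suc k) ∸ (toℕ n ℕ.+ 2))  ≡⟨ cong (λ i → toℕ n ℕ.+ (suc (suc k) ∸ i)) (ℕ.+-comm (toℕ n) 2) ⟩
  toℕ n ℕ.+ (k ∸ toℕ n)                    ≡⟨ ℕ.m+[n∸m]≡n (Fin.toℕ≤pred[n] n) ⟩
  k                                        ∎

module _ {m : ℚ} {q : ℕ} .{{_ : NonZero q}} where

  private
    1/q : ℚ
    1/q = + 1 / q

  inMZdiv-0 : inMZdiv m q ℚ.0ℚ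
  inMZdiv-0 = + 0 , sym (begin
    m * ℤ→ℚ (+ 0) * 1/q  ≡⟨ cong (_* 1/q) (ℚ.*-zeroʳ m) ⟩
    ℚ.0ℚ * 1/q           ≡⟨ ℚ.*-zeroˡ 1/q ⟩
    ℚ.0ℚ                 ∎)

  inMZdiv-+ : ∀ {x y} → inMZdiv m q x → inMZdiv m q y → inMZdiv m q (x + y)
  inMZdiv-+ {x} {y} (s , x≡ms/q) (t , y≡mt/q) = s ℤ.+ t , (begin
    x + y                                   ≡⟨ cong₂ _+_ x≡ms/q y≡mt/q ⟩
    m * ℤ→ℚ s * 1/q + m * ℤ→ℚ t * 1/q       ≡⟨ ℚ.*-distribʳ-+ 1/q (m * ℤ→ℚ s) (m * ℤ→ℚ t) ⟨
    (m * ℤ→ℚ s + m * ℤ→ℚ t) * 1/q           ≡⟨ cong (_* 1/q) (ℚ.*-distribˡ-+ m (ℤ→ℚ s) (ℤ→ℚ t)) ⟨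
    m * (ℤ→ℚ s + ℤ→ℚ t) * 1/q               ≡⟨ cong (λ u → m * u * 1/q) (ℤ→ℚ-+ s t) ⟨
    m * ℤ→ℚ (s ℤ.+ t) * 1/q                 ∎)

  inMZdiv-sumFin : ∀ n {f} → (∀ i → inMZdiv m q (f i)) → inMZdiv m q (sumFin n f)
  inMZdiv-sumFin zero    _  = inMZdiv-0
  inMZdiv-sumFin (suc n) f∈ = inMZdiv-+ (f∈ zero) (inMZdiv-sumFin n (f∈ ∘ suc))

  inMZdiv-ℤ→ℚ-* : ∀ z {x} → inMZdiv m q x → inMZdiv m q (ℤ→ℚ z * x)
  inMZdiv-ℤ→ℚ-* z {x} (t , x≡mt/q) = z ℤ.* t , (begin
    ℤ→ℚ z * x                       ≡⟨ cong (ℤ→ℚ z *_) x≡mt/q ⟩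
    ℤ→ℚ z * (m * ℤ→ℚ t * 1/q)       ≡⟨ ℚ.*-assoc (ℤ→ℚ z) (m * ℤ→ℚ t) 1/q ⟨
    ℤ→ℚ z * (m * ℤ→ℚ t) * 1/q       ≡⟨ cong (_* 1/q) (x∙yz≈y∙xz (ℤ→ℚ z) m (ℤ→ℚ t)) ⟩
    m * (ℤ→ℚ z * ℤ→ℚ t) * 1/q       ≡⟨ cong (λ u → m * u * 1/q) (ℤ→ℚ-* z t) ⟨
    m * ℤ→ℚ (z ℤ.* t) * 1/q         ∎)

  q*x∈mℤ⇒inMZdiv : ∀ {x} → (∃ λ t → ℤ→ℚ (+ q) * x ≡ m * ℤ→ℚ t) → inMZdiv m q x
  q*x∈mℤ⇒inMZdiv {x} (t , q*x≡m*t) = t , (begin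
    x                         ≡⟨ ℚ.*-identityˡ x ⟨
    ℚ.1ℚ * x                  ≡⟨ cong (_* x) (i/n*n≡i (+ 1) q) ⟨
    1/q * ℤ→ℚ (+ q) * x       ≡⟨ xy∙z≈yz∙x 1/q (ℤ→ℚ (+ q)) x ⟩
    ℤ→ℚ (+ q) * x * 1/q       ≡⟨ cong (_* 1/q) q*x≡m*t ⟩
    m * ℤ→ℚ t * 1/q           ∎)

  monomial-inMZdiv : ∀ {a c x} → ℤ→ℚ c * x ≡ ℤ→ℚ a → + q ℤˢ.∣ c → ∀ j e {p} →
    (∃ λ t → ℤ→ℚ (+ (q ℕ.^ suc j)) * p ≡ m * ℤ→ℚ t) →
    inMZdiv m q (ℤ→ℚ (c ℤ.^ (j ℕ.+ e)) * (p * x ^ℚ e))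
  monomial-inMZdiv {a} {c} {x} c*x≡a (ℤˢ.divides w c≡w*q) j e {p} (t , q^[j+1]*p≡m*t) =
    subst (inMZdiv m q) (sym monomial≡)
      (inMZdiv-ℤ→ℚ-* (w ℤ.^ j ℤ.* a ℤ.^ e) (q*x∈mℤ⇒inMZdiv (t , q*[q^j*p]≡m*t)))
    where
    Q : ℚ
    Q = ℤ→ℚ (+ q)
    q*[q^j*p]≡m*t : Q * (Q ^ℚ j * p) ≡ m * ℤ→ℚ t
    q*[q^j*p]≡m*t = begin
      Q * (Q ^ℚ j * p)                 ≡⟨ ℚ.*-assoc Q (Q ^ℚ j) p ⟨
      Q ^ℚ suc j * p                   ≡⟨ cong (_* p) (ℤ→ℚ-pos-^ q (suc j)) ⟨
      ℤ→ℚ (+ (q ℕ.^ suc j)) * p        ≡⟨ q^[j+1]*p≡m*t ⟩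
      m * ℤ→ℚ t                        ∎
    monomial≡ : ℤ→ℚ (c ℤ.^ (j ℕ.+ e)) * (p * x ^ℚ e) ≡ ℤ→ℚ (w ℤ.^ j ℤ.* a ℤ.^ e) * (Q ^ℚ j * p)
    monomial≡ = begin
      ℤ→ℚ (c ℤ.^ (j ℕ.+ e)) * (p * x ^ℚ e)
        ≡⟨ cong (_* (p * x ^ℚ e)) (ℤ→ℚ-^ c (j ℕ.+ e)) ⟩
      ℤ→ℚ c ^ℚ (j ℕ.+ e) * (p * x ^ℚ e)
        ≡⟨ ^ℚ-clear-denominators c*x≡a (trans (cong ℤ→ℚ c≡w*q) (ℤ→ℚ-* w (+ q))) j e p ⟩
      ℤ→ℚ w ^ℚ j * ℤ→ℚ a ^ℚ e * (Q ^ℚ j * p)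
        ≡⟨ cong (_* (Q ^ℚ j * p)) (cong₂ _*_ (ℤ→ℚ-^ w j) (ℤ→ℚ-^ a e)) ⟨
      ℤ→ℚ (w ℤ.^ j) * ℤ→ℚ (a ℤ.^ e) * (Q ^ℚ j * p)
        ≡⟨ cong (_* (Q ^ℚ j * p)) (ℤ→ℚ-* (w ℤ.^ j) (a ℤ.^ e)) ⟨
      ℤ→ℚ (w ℤ.^ j ℤ.* a ℤ.^ e) * (Q ^ℚ j * p)
        ∎

  c^[k∸2]*P[a/c]-inMZdiv : ∀ k (P : Poly k) → inP k m q P → ∀ {a c} (c≢0 : c ≢ + 0) → + q ℤˢ.∣ c →
    inMZdiv m q (ℤ→ℚ (c ℤ.^ (k ∸ 2)) * evalPoly k P (fracℤ a c c≢0))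
  c^[k∸2]*P[a/c]-inMZdiv k P P∈𝒫 {a} {c} c≢0 q∣c =
    subst (inMZdiv m q) (sym (*-distribˡ-sumFin (k ∸ 1) (ℤ→ℚ (c ℤ.^ (k ∸ 2))) _))
      (inMZdiv-sumFin (k ∸ 1) term-inMZdiv)
    where
    x : ℚ
    x = fracℤ a c c≢0
    c*x≡a : ℤ→ℚ c * x ≡ ℤ→ℚ a
    c*x≡a = trans (ℚ.*-comm (ℤ→ℚ c) x) (fracℤ*c≡a a c c≢0)
    term-inMZdiv : ∀ n → inMZdiv m q (ℤ→ℚ (c ℤ.^ (k ∸ 2)) * (P n * x ^ℚ (k ∸ toℕ n ∸ 2)))
    term-inMZdiv n =
      subst (λ d → inMZdiv m q (ℤ→ℚ (c ℤ.^ d) * (P n * x ^ℚ (k ∸ toℕ n ∸ 2))))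
        (toℕ+[k∸toℕ∸2]≡k∸2 k n)
        (monomial-inMZdiv {a = a} c*x≡a q∣c (toℕ n) (k ∸ toℕ n ∸ 2) (P∈𝒫 n))

mainTheorem14 : (k q₁ q₂ : ℕ) → 2 ≤ k → .{{_ : NonZero q₁}} → .{{_ : NonZero q₂}} →
  (m : ℚ) → (γ : Γ₁ (q₁ ℕ.* q₂)) → (c≢0 : Γ₁.c γ ≢ + 0) →
  (P₀ : Poly k) → inP k m q₁ P₀ →
  inMZdiv m q₁ (ℤ→ℚ (Γ₁.c γ ℤ.^ (k ∸ 2)) ℚ.* evalPoly k P₀ (fracℤ (Γ₁.a γ) (Γ₁.c γ) c≢0))
mainTheorem14 k q₁ q₂ _ m γ c≢0 P₀ P₀∈𝒫 =
  c^[k∸2]*P[a/c]-inMZdiv {m = m} k P₀ P₀∈𝒫 c≢0 (ℤˢ.∣ᵤ⇒∣ (ℕ.∣-trans (ℕ.m∣m*n q₂) (Γ₁.c≡0 γ)))
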